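{- Every finite graph $G$ of sd-degeneracy $d$ admits a clean signed tree model of width $d+1$, i.e., there is a clean signed tree model $(T,A(T),B(T))$ of width $d+1$ whose leaf set is $V(G)$ and which defines $G$.
   Context: For distinct vertices $u,v$ of a graph $G$, $\mathrm{sd}_G(u,v) := |(N_G(u)\setminus\{v\}) \triangle (N_G(v)\setminus\{u\})|$. The sd-degeneracy of $G$ is the least nonnegative integer $d$ such that there is an ordering $v_1,\dots,v_n$ of $V(G)$ with: for every $i\in[n-1]$ there is $j>i$ with $\mathrm{sd}_{G-\{v_1,\dots,v_{i-1}\}}(v_i,v_j)\le d$. Rooted trees: $u\preceq_T u'$ means $u$ is an ancestor of $u'$ (possibly equal), $u\prec_T u'$ a strict ancestor. For unordered pairs, $uv\preceq_T u'v'$ if ($u\preceq_T u'$ and $v\preceq_T v'$) or ($v\preceq_T u'$ and $u\preceq_T v'$); $uv\prec_T u'v'$ if moreover $\{u,v\}\ne\{u',v'\}$. A full binary tree is a rooted tree whose non-leaf nodes have exactly two children; $L(T)$ is its leaf set. A transversal pair of $T$ is an unordered pair of nodes neither of which is an ancestor of the other. Two transversal pairs $uv,u'v'$ cross if $u\prec_T u'$ and $v'\prec_T v$, or $u'\prec_T u$ and $v\prec_T v'$, or $u\prec_T v'$ and $u'\prec_T v$, or $v'\prec_T u$ and $v\prec_T u'$. A signed tree model is a triple $(T,A(T),B(T))$ where $T$ is a full binary tree and $A(T)$ (green edges/anti-edges) and $B(T)$ (blue edges) are disjoint sets of transversal pairs of $T$ such that no two pairs in $A(T)\cup B(T)$ cross.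 It defines the graph $G$ on $L(T)$ in which leaves $u,v$ are adjacent iff there is $u'v'\in B(T)$ with $u'v'\preceq_T uv$ and there is no $u''v''\in A(T)$ with $u'v'\prec_T u''v''\preceq_T uv$. Its width is the degeneracy of the graph $(V(T),A(T)\cup B(T))$. It is clean if every pair of sibling nodes of $T$ belongs to $A(T)\cup B(T)$. -}

module Defs where

open import Data.Nat using (ℕ; zero; suc; _+_; _≤_; _<_)
open import Data.Fin using (Fin; toℕ) renaming (zero to fzero; suc to fsuc)
import Data.Fin as Fin
open import Data.Bool using (Bool; true; false; not; _∧_; _∨_; _xor_; if_then_else_)
open import Data.List using (List; length)
open import Data.List.Membership.Propositional using (_∈_)
open import Data.Product using (Σ; ∃; _×_; _,_)
open import Data.Sum using (_⊎_)
open import Relation.Nullary using (¬_)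
open import Relation.Nullary.Decidable using (⌊_⌋)
open import Relation.Binary.PropositionalEquality using (_≡_; _≢_)
open import Function.Definitions using (Injective)
open import Function.Bundles using (_⇔_)

record Graph (n : ℕ) : Set where
  field
    adj        : Fin n → Fin n → Bool
    adj-sym    : ∀ u v → adj u v ≡ adj v u
    adj-irrefl : ∀ v → adj v v ≡ false
open Graph public

count : ∀ {n} → (Fin n → Bool) → ℕ
count {zero}  p = 0
count {suc n} p = (if p fzero then 1 else 0) + count (λ x → p (fsuc x))

-- sd_{G[S]}(u,v) = |(N(u) \ {v}) △ (N(v) \ {u})| computed in the induced
-- subgraph G[S], where S is given as a Boolean mask (u, v ∈ S).
sdIn : ∀ {n} → Graph n → (Fin n → Bool) → Fin n → Fin n → ℕ
sdIn G S u v =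
  count (λ x → S x ∧ not ⌊ x Fin.≟ u ⌋ ∧ not ⌊ x Fin.≟ v ⌋
               ∧ (adj G u x xor adj G v x))

-- An ordering v_1,…,v_n of V(G) is given by its (injective, hence
-- bijective) position map rank : Fin n → Fin n  (rank v_i = i).
-- G - {v_1,…,v_{i-1}} is the induced subgraph on {x : rank v_i ≤ rank x}.
remaining : ∀ {n} → (Fin n → Fin n) → Fin n → (Fin n → Bool)
remaining rank v x = ⌊ toℕ (rank v) Data.Nat.≤? toℕ (rank x) ⌋

SdOrdering : ∀ {n} → Graph n → ℕ → Set
SdOrdering {n} G d =
  Σ (Fin n → Fin n) λ rank → Injective _≡_ _≡_ rank ×
    (∀ v → suc (toℕ (rank v)) < n →
      Σ (Fin n) λ w → toℕ (rank v) < toℕ (rank w) ×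
        sdIn G (remaining rank v) v w ≤ d)

SdDegeneracy : ∀ {n} → Graph n → ℕ → Set
SdDegeneracy G d = SdOrdering G d × (∀ d' → d' < d → ¬ SdOrdering G d')

DegeneracyAtMost : (X : Set) → (X → X → Set) → ℕ → Set
DegeneracyAtMost X E k =
  Σ (X → ℕ) λ rank → Injective _≡_ _≡_ rank ×
    (∀ x → Σ (List X) λ xs → length xs ≤ k ×
       (∀ y → rank x < rank y → E x y → y ∈ xs))

data Tree (V : Set) : Set where
  leaf : V → Tree V
  node : Tree V → Tree V → Tree V

data Pos {V : Set} : Tree V → Set where
  here  : ∀ {t} → Pos t
  left  : ∀ {l r} → Pos l → Pos (node l r)
  right : ∀ {l r} → Pos r → Pos (node l r)

data _≼_ {V : Set} : {t : Tree V} → Pos t → Pos t → Set where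
  here≼  : ∀ {t} {p : Pos t} → here ≼ p
  left≼  : ∀ {l r} {p q : Pos l} → p ≼ q → left {r = r} p ≼ left q
  right≼ : ∀ {l r} {p q : Pos r} → p ≼ q → right {l = l} p ≼ right q

_≺_ : ∀ {V} {t : Tree V} → Pos t → Pos t → Set
p ≺ q = p ≼ q × p ≢ q

data LeafAt {V : Set} : {t : Tree V} → Pos t → V → Set where
  atLeaf  : ∀ {v} → LeafAt {t = leaf v} here v
  inLeft  : ∀ {l r p v} → LeafAt {t = l} p v → LeafAt {t = node l r} (left p) v
  inRight : ∀ {l r p v} → LeafAt {t = r} p v → LeafAt {t = node l r} (right p) v

data Siblings {V : Set} : {t : Tree V} → Pos t → Pos t → Set where
  sibs  : ∀ {l r} → Siblings {t = node l r} (left here) (right here)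
  sibL  : ∀ {l r p q} → Siblings {t = l} p q → Siblings {t = node l r} (left p) (left q)
  sibR  : ∀ {l r p q} → Siblings {t = r} p q → Siblings {t = node l r} (right p) (right q)

module _ {V : Set} {t : Tree V} where

  Transversal : Pos t → Pos t → Set
  Transversal u v = ¬ (u ≼ v) × ¬ (v ≼ u)

  PairLe : Pos t → Pos t → Pos t → Pos t → Set
  PairLe u v u' v' = (u ≼ u' × v ≼ v') ⊎ (v ≼ u' × u ≼ v')

  SamePair : Pos t → Pos t → Pos t → Pos t → Set
  SamePair u v u' v' = (u ≡ u' × v ≡ v') ⊎ (u ≡ v' × v ≡ u')

  PairLt : Pos t → Pos t → Pos t → Pos t → Set
  PairLt u v u' v' = PairLe u v u' v' × ¬ SamePair u v u' v'

  Cross : Pos t → Pos t → Pos t → Pos t → Set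
  Cross u v u' v' =
      (u ≺ u' × v' ≺ v) ⊎ (u' ≺ u × v ≺ v')
    ⊎ (u ≺ v' × u' ≺ v) ⊎ (v' ≺ u × v ≺ u')

-- Signed tree models.  A(T), B(T) are sets of unordered pairs of nodes,
-- represented as symmetric Boolean relations on the nodes of T.

record SignedTreeModel (V : Set) : Set where
  field
    T : Tree V
    A : Pos T → Pos T → Bool
    B : Pos T → Pos T → Bool
    A-sym : ∀ u v → A u v ≡ A v u
    B-sym : ∀ u v → B u v ≡ B v u
    A-transversal : ∀ u v → A u v ≡ true → Transversal u v
    B-transversal : ∀ u v → B u v ≡ true → Transversal u v
    disjoint : ∀ u v → A u v ≡ true → B u v ≡ false
    noCross : ∀ u v u' v' → (A u v ∨ B u v) ≡ true → (A u' v' ∨ B u' v') ≡ true →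
              ¬ Cross u v u' v'
open SignedTreeModel public

module _ {V : Set} (M : SignedTreeModel V) where

  ABEdge : Pos (T M) → Pos (T M) → Set
  ABEdge u v = (A M u v ∨ B M u v) ≡ true

  WidthAtMost : ℕ → Set
  WidthAtMost k = DegeneracyAtMost (Pos (T M)) ABEdge k

  Clean : Set
  Clean = ∀ p q → Siblings p q → ABEdge p q

  -- the leaf set L(T) is V: every v ∈ V labels exactly one leaf
  -- (every leaf carries a label by construction)
  LeafSetIs : Set
  LeafSetIs = ∀ v → Σ (Pos (T M)) λ p → LeafAt p v ×
                (∀ q → LeafAt q v → q ≡ p)

  ModelAdj : Pos (T M) → Pos (T M) → Set
  ModelAdj u v =
    Σ (Pos (T M)) λ u' → Σ (Pos (T M)) λ v' →
      B M u' v' ≡ true × PairLe u' v' u v ×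
      ¬ (Σ (Pos (T M)) λ u'' → Σ (Pos (T M)) λ v'' →
           A M u'' v'' ≡ true × PairLt u' v' u'' v'' × PairLe u'' v'' u v)

Defines : ∀ {n} → SignedTreeModel (Fin n) → Graph n → Set
Defines {n} M G =
  LeafSetIs M ×
  (∀ (x y : Fin n) (p q : Pos (T M)) → x ≢ y → LeafAt p x → LeafAt q y →
     (adj G x y ≡ true ⇔ ModelAdj M p q))

{-# OPTIONS --safe #-}
-- Add the vertices in reverse sd-order, keeping a clean model of the subgraph induced by the
-- vertices added so far.  When v is added, let w be its later partner with sd(v, w) ≤ d in the
-- remaining graph, and replace the leaf of w by a cherry with leaves w and v.  The sibling pair
-- {w, v} is blue or green according to vw, and the leaf of v is paired directly with the leaf of
-- each of the ≤ d vertices z distinguishing v from w, blue iff vz is an edge.  Every other vertex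
-- is adjacent to v iff it is adjacent to w, and the pairs above v are those above the old leaf of
-- w, so the model still defines the graph; the new pairs join two leaves, so they cross nothing.
-- Putting the leaf of v first in the degeneracy order, its later neighbours are the leaf of w and
-- at most d distinguishing leaves, so the width stays at most d + 1.
module Submission where

open import Defs
open import Data.Bool using (Bool; true; false; not; _∧_; _∨_; _xor_; if_then_else_)
open import Data.Bool.Properties using (not-involutive; ∨-zeroʳ; ∨-identityʳ; ∨-inverseˡ; ∧-conicalˡ; ∧-conicalʳ; T-≡)
open import Data.Empty using (⊥; ⊥-elim)
open import Data.Fin using (Fin; toℕ; fromℕ<; punchOut) renaming (zero to fzero; suc to fsuc)
import Data.Fin as Fin
open import Data.Fin.Properties using (toℕ-injective; toℕ<n; toℕ-fromℕ<; any?; punchOut-injective; injective⇒≤)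
open import Data.List using (List; []; _∷_; map; length)
open import Data.List.Properties using (length-map)
open import Data.List.Membership.Propositional using (_∈_)
open import Data.List.Membership.Propositional.Properties using (∈-map⁺)
open import Data.List.Relation.Unary.Any using (here; there)
open import Data.Maybe using (Maybe; just; nothing; maybe′; _>>=_)
open import Data.Maybe.Properties using (just-injective)
open import Data.Nat using (ℕ; zero; suc; _+_; _≤_; _<_; z≤n; s≤s)
import Data.Nat as ℕ
open import Data.Nat.Properties using (≤-refl; ≤-reflexive; <-irrefl; ≤-pred; <⇒≤; ≤∧≢⇒<; ≤-antisym; +-identityʳ; +-suc; m≤m+n; suc-injective)
open import Data.Product using (Σ; ∃; ∃₂; _×_; _,_; proj₁; proj₂)
import Data.Product as Product
open import Data.Sum using (_⊎_; inj₁; inj₂)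
import Data.Sum as Sum
open import Function using (_∘_; id)
open import Function.Bundles using (_⇔_; mk⇔; Equivalence)
open import Function.Related.Propositional as Related using (equivalence)
open import Function.Construct.Symmetry using (⇔-sym)
open import Function.Definitions using (Injective)
open import Relation.Binary.Definitions using (DecidableEquality)
open import Relation.Binary.PropositionalEquality
open import Relation.Nullary using (¬_; Dec; yes; no; contradiction)
open import Relation.Nullary.Decidable using (⌊_⌋; isYes≗does; dec-true; dec-false; toWitnessFalse)
import Relation.Nullary.Decidable as Dec

private
  variable
    V : Set
    t : Tree V
    p q z : Pos t
    x y : V

-- Positions in a full binary tree

≼-refl : p ≼ p
≼-refl {p = here}    = here≼
≼-refl {p = left p}  = left≼ ≼-refl
≼-refl {p = right p} = right≼ ≼-refl

≼-trans : p ≼ q → q ≼ z → p ≼ z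
≼-trans here≼      _          = here≼
≼-trans (left≼ a)  (left≼ b)  = left≼ (≼-trans a b)
≼-trans (right≼ a) (right≼ b) = right≼ (≼-trans a b)

≼-antisym : p ≼ q → q ≼ p → p ≡ q
≼-antisym here≼      here≼      = refl
≼-antisym (left≼ a)  (left≼ b)  = cong left (≼-antisym a b)
≼-antisym (right≼ a) (right≼ b) = cong right (≼-antisym a b)

_≟ₚ_ : DecidableEquality (Pos t)
here    ≟ₚ here    = yes refl
left p  ≟ₚ left q  = Dec.map′ (cong left) (λ { refl → refl }) (p ≟ₚ q)
right p ≟ₚ right q = Dec.map′ (cong right) (λ { refl → refl }) (p ≟ₚ q)
here    ≟ₚ left _  = no λ ()
here    ≟ₚ right _ = no λ ()
left _  ≟ₚ here    = no λ ()
left _  ≟ₚ right _ = no λ ()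
right _ ≟ₚ here    = no λ ()
right _ ≟ₚ left _  = no λ ()

label : {t : Tree V} → Pos t → Maybe V
label {t = leaf x}   here = just x
label {t = node _ _} here = nothing
label (left p)  = label p
label (right p) = label p

label-sound : {t : Tree V} {p : Pos t} → label p ≡ just x → LeafAt p x
label-sound {t = leaf _}   {p = here}    refl = atLeaf
label-sound {t = node _ _} {p = left p}  e    = inLeft (label-sound e)
label-sound {t = node _ _} {p = right p} e    = inRight (label-sound e)

label-complete : LeafAt p x → label p ≡ just x
label-complete atLeaf      = refl
label-complete (inLeft h)  = label-complete h
label-complete (inRight h) = label-complete h

LeafAt-functional : LeafAt p x → LeafAt p y → x ≡ y
LeafAt-functional hx hy = just-injective (trans (sym (label-complete hx)) (label-complete hy))

LeafAt-maximal : LeafAt p x → p ≼ q → q ≡ p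
LeafAt-maximal {q = here} atLeaf here≼ = refl
LeafAt-maximal (inLeft h)  (left≼ a)  = cong left (LeafAt-maximal h a)
LeafAt-maximal (inRight h) (right≼ a) = cong right (LeafAt-maximal h a)

LeafAt⇒¬≺ : LeafAt p x → ¬ p ≺ q
LeafAt⇒¬≺ h (p≼q , p≢q) = p≢q (sym (LeafAt-maximal h p≼q))

leaves-transversal : LeafAt p x → LeafAt q y → p ≢ q → Transversal p q
leaves-transversal hp hq p≢q =
  (λ p≼q → p≢q (sym (LeafAt-maximal hp p≼q))) , (λ q≼p → p≢q (LeafAt-maximal hq q≼p))

leaves-¬Crossˡ : ∀ {p' q' : Pos t} → LeafAt p x → LeafAt q y → ¬ Cross p q p' q'
leaves-¬Crossˡ hp hq (inj₁ (p≺ , _))               = LeafAt⇒¬≺ hp p≺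
leaves-¬Crossˡ hp hq (inj₂ (inj₁ (_ , q≺)))        = LeafAt⇒¬≺ hq q≺
leaves-¬Crossˡ hp hq (inj₂ (inj₂ (inj₁ (p≺ , _)))) = LeafAt⇒¬≺ hp p≺
leaves-¬Crossˡ hp hq (inj₂ (inj₂ (inj₂ (_ , q≺)))) = LeafAt⇒¬≺ hq q≺

leaves-¬Crossʳ : ∀ {p' q' : Pos t} → LeafAt p x → LeafAt q y → ¬ Cross p' q' p q
leaves-¬Crossʳ hp hq (inj₁ (_ , q≺))               = LeafAt⇒¬≺ hq q≺
leaves-¬Crossʳ hp hq (inj₂ (inj₁ (p≺ , _)))        = LeafAt⇒¬≺ hp p≺
leaves-¬Crossʳ hp hq (inj₂ (inj₂ (inj₁ (_ , p≺)))) = LeafAt⇒¬≺ hp p≺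
leaves-¬Crossʳ hp hq (inj₂ (inj₂ (inj₂ (q≺ , _)))) = LeafAt⇒¬≺ hq q≺

leaf? : DecidableEquality V → (t : Tree V) (x : V) → Dec (∃ λ (p : Pos t) → LeafAt p x)
leaf? _≟_ (leaf y) x with y ≟ x
... | yes refl = yes (here , atLeaf)
... | no y≢x   = no λ { (here , atLeaf) → y≢x refl }
leaf? _≟_ (node l r) x with leaf? _≟_ l x | leaf? _≟_ r x
... | yes (p , h) | _           = yes (left p , inLeft h)
... | no _        | yes (p , h) = yes (right p , inRight h)
... | no ∉l       | no ∉r       =
  no λ { (left p , inLeft h) → ∉l (p , h) ; (right p , inRight h) → ∉r (p , h) }

-- Giving a leaf a new sibling

module Split {V : Set} (v : V) where

  private
    variable
      s : Tree V
      pw a b : Pos s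
      w : V

  split : LeafAt {t = s} pw w → Tree V
  split (atLeaf {v = w})   = node (leaf w) (leaf v)
  split (inLeft {r = r} h)  = node (split h) r
  split (inRight {l = l} h) = node l (split h)

  embed : (h : LeafAt {t = s} pw w) → Pos s → Pos (split h)
  embed atLeaf      here      = here
  embed (inLeft h)  here      = here
  embed (inLeft h)  (left a)  = left (embed h a)
  embed (inLeft h)  (right a) = right a
  embed (inRight h) here      = here
  embed (inRight h) (left a)  = left a
  embed (inRight h) (right a) = right (embed h a)

  keptLeaf newLeaf : (h : LeafAt {t = s} pw w) → Pos (split h)
  keptLeaf atLeaf      = left here
  keptLeaf (inLeft h)  = left (keptLeaf h)
  keptLeaf (inRight h) = right (keptLeaf h)
  newLeaf atLeaf       = right here
  newLeaf (inLeft h)   = left (newLeaf h)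
  newLeaf (inRight h)  = right (newLeaf h)

  data View {s : Tree V} {pw : Pos s} {w : V} (h : LeafAt pw w) : Pos (split h) → Set where
    old  : (a : Pos s) → View h (embed h a)
    kept : View h (keptLeaf h)
    new  : View h (newLeaf h)

  private
    viewˡ : ∀ {l r : Tree V} {pw : Pos l} {h : LeafAt pw w} {q} → View h q → View (inLeft {r = r} h) (left q)
    viewˡ (old a) = old (left a)
    viewˡ kept    = kept
    viewˡ new     = new

    viewʳ : ∀ {l r : Tree V} {pw : Pos r} {h : LeafAt pw w} {q} → View h q → View (inRight {l = l} h) (right q)
    viewʳ (old a) = old (right a)
    viewʳ kept    = kept
    viewʳ new     = new

  view : (h : LeafAt {t = s} pw w) (q : Pos (split h)) → View h q
  view atLeaf      here         = old here
  view atLeaf      (left here)  = kept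
  view atLeaf      (right here) = new
  view (inLeft h)  here         = old here
  view (inLeft h)  (left q)     = viewˡ (view h q)
  view (inLeft h)  (right q)    = old (right q)
  view (inRight h) here         = old here
  view (inRight h) (left q)     = old (left q)
  view (inRight h) (right q)    = viewʳ (view h q)

  view-embed : (h : LeafAt {t = s} pw w) (a : Pos s) → view h (embed h a) ≡ old a
  view-embed atLeaf      here      = refl
  view-embed (inLeft h)  here      = refl
  view-embed (inLeft h)  (left a)  = cong viewˡ (view-embed h a)
  view-embed (inLeft h)  (right a) = refl
  view-embed (inRight h) here      = refl
  view-embed (inRight h) (left a)  = refl
  view-embed (inRight h) (right a) = cong viewʳ (view-embed h a)

  view-keptLeaf : (h : LeafAt {t = s} pw w) → view h (keptLeaf h) ≡ kept
  view-keptLeaf atLeaf      = refl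
  view-keptLeaf (inLeft h)  = cong viewˡ (view-keptLeaf h)
  view-keptLeaf (inRight h) = cong viewʳ (view-keptLeaf h)

  view-newLeaf : (h : LeafAt {t = s} pw w) → view h (newLeaf h) ≡ new
  view-newLeaf atLeaf      = refl
  view-newLeaf (inLeft h)  = cong viewˡ (view-newLeaf h)
  view-newLeaf (inRight h) = cong viewʳ (view-newLeaf h)

  contract : (h : LeafAt {t = s} pw w) → Pos (split h) → Pos s
  contract atLeaf      _         = here
  contract (inLeft h)  here      = here
  contract (inLeft h)  (left q)  = left (contract h q)
  contract (inLeft h)  (right q) = right q
  contract (inRight h) here      = here
  contract (inRight h) (left q)  = left q
  contract (inRight h) (right q) = right (contract h q)

  contract-embed : (h : LeafAt {t = s} pw w) (a : Pos s) → contract h (embed h a) ≡ a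
  contract-embed atLeaf      here      = refl
  contract-embed (inLeft h)  here      = refl
  contract-embed (inLeft h)  (left a)  = cong left (contract-embed h a)
  contract-embed (inLeft h)  (right a) = refl
  contract-embed (inRight h) here      = refl
  contract-embed (inRight h) (left a)  = refl
  contract-embed (inRight h) (right a) = cong right (contract-embed h a)

  contract-newLeaf : (h : LeafAt {t = s} pw w) → contract h (newLeaf h) ≡ pw
  contract-newLeaf atLeaf      = refl
  contract-newLeaf (inLeft h)  = cong left (contract-newLeaf h)
  contract-newLeaf (inRight h) = cong right (contract-newLeaf h)

  embed≼⇒≼contract : (h : LeafAt {t = s} pw w) {a : Pos s} {q : Pos (split h)} →
                     embed h a ≼ q → a ≼ contract h q
  embed≼⇒≼contract atLeaf      {here}    _           = here≼
  embed≼⇒≼contract (inLeft h)  {here}    _           = here≼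
  embed≼⇒≼contract (inLeft h)  {left a}  (left≼ le)  = left≼ (embed≼⇒≼contract h le)
  embed≼⇒≼contract (inLeft h)  {right a} (right≼ le) = right≼ le
  embed≼⇒≼contract (inRight h) {here}    _           = here≼
  embed≼⇒≼contract (inRight h) {left a}  (left≼ le)  = left≼ le
  embed≼⇒≼contract (inRight h) {right a} (right≼ le) = right≼ (embed≼⇒≼contract h le)

  ≼contract⇒embed≼ : (h : LeafAt {t = s} pw w) {a : Pos s} {q : Pos (split h)} →
                     a ≼ contract h q → embed h a ≼ q
  ≼contract⇒embed≼ atLeaf      {here}                 _           = here≼
  ≼contract⇒embed≼ (inLeft h)  {here}                 _           = here≼
  ≼contract⇒embed≼ (inLeft h)  {left a}  {left q}     (left≼ le)  = left≼ (≼contract⇒embed≼ h le)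
  ≼contract⇒embed≼ (inLeft h)  {right a} {right q}    (right≼ le) = right≼ le
  ≼contract⇒embed≼ (inRight h) {here}                 _           = here≼
  ≼contract⇒embed≼ (inRight h) {left a}  {left q}     (left≼ le)  = left≼ le
  ≼contract⇒embed≼ (inRight h) {right a} {right q}    (right≼ le) = right≼ (≼contract⇒embed≼ h le)

  keptLeaf-leaf : (h : LeafAt {t = s} pw w) → LeafAt (keptLeaf h) w
  keptLeaf-leaf atLeaf      = inLeft atLeaf
  keptLeaf-leaf (inLeft h)  = inLeft (keptLeaf-leaf h)
  keptLeaf-leaf (inRight h) = inRight (keptLeaf-leaf h)

  newLeaf-leaf : (h : LeafAt {t = s} pw w) → LeafAt (newLeaf h) v
  newLeaf-leaf atLeaf      = inRight atLeaf
  newLeaf-leaf (inLeft h)  = inLeft (newLeaf-leaf h)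
  newLeaf-leaf (inRight h) = inRight (newLeaf-leaf h)

  embed-leaf : ∀ {x} (h : LeafAt {t = s} pw w) → b ≢ pw → LeafAt b x → LeafAt (embed h b) x
  embed-leaf atLeaf      b≢pw atLeaf       = ⊥-elim (b≢pw refl)
  embed-leaf (inLeft h)  b≢pw (inLeft hb)  = inLeft (embed-leaf h (b≢pw ∘ cong left) hb)
  embed-leaf (inLeft h)  _    (inRight hb) = inRight hb
  embed-leaf (inRight h) _    (inLeft hb)  = inLeft hb
  embed-leaf (inRight h) b≢pw (inRight hb) = inRight (embed-leaf h (b≢pw ∘ cong right) hb)

  embed-leaf⁻ : ∀ {x} (h : LeafAt {t = s} pw w) {b : Pos s} → LeafAt (embed h b) x → b ≢ pw × LeafAt b x
  embed-leaf⁻ atLeaf      {here}    ()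
  embed-leaf⁻ (inLeft h)  {here}    ()
  embed-leaf⁻ (inRight h) {here}    ()
  embed-leaf⁻ (inLeft h)  {left b}  (inLeft hb)  =
    Product.map (λ b≢pw → λ { refl → b≢pw refl }) inLeft (embed-leaf⁻ h hb)
  embed-leaf⁻ (inLeft h)  {right b} (inRight hb) = (λ ()) , inRight hb
  embed-leaf⁻ (inRight h) {left b}  (inLeft hb)  = (λ ()) , inLeft hb
  embed-leaf⁻ (inRight h) {right b} (inRight hb) =
    Product.map (λ b≢pw → λ { refl → b≢pw refl }) inRight (embed-leaf⁻ h hb)

  contract-leaf : ∀ {x} (h : LeafAt {t = s} pw w) {q : Pos (split h)} →
                  q ≢ newLeaf h → LeafAt q x → LeafAt (contract h q) x
  contract-leaf atLeaf      _    (inLeft atLeaf)  = atLeaf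
  contract-leaf atLeaf      q≢nl (inRight atLeaf) = ⊥-elim (q≢nl refl)
  contract-leaf (inLeft h)  q≢nl (inLeft hq)      = inLeft (contract-leaf h (q≢nl ∘ cong left) hq)
  contract-leaf (inLeft h)  _    (inRight hq)     = inRight hq
  contract-leaf (inRight h) _    (inLeft hq)      = inLeft hq
  contract-leaf (inRight h) q≢nl (inRight hq)     = inRight (contract-leaf h (q≢nl ∘ cong right) hq)

  embed-mono : (h : LeafAt {t = s} pw w) → a ≼ b → embed h a ≼ embed h b
  embed-mono {a = a} {b = b} h a≼b = ≼contract⇒embed≼ h (subst (a ≼_) (sym (contract-embed h b)) a≼b)

  embed-reflect : (h : LeafAt {t = s} pw w) → embed h a ≼ embed h b → a ≼ b
  embed-reflect {a = a} {b = b} h le = subst (a ≼_) (contract-embed h b) (embed≼⇒≼contract h le)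

  embed-Cross⁻ : ∀ (h : LeafAt {t = s} pw w) {a b c d} →
                 Cross (embed h a) (embed h b) (embed h c) (embed h d) → Cross a b c d
  embed-Cross⁻ h = Sum.map reflect₂ (Sum.map reflect₂ (Sum.map reflect₂ reflect₂))
    where
    reflect : ∀ {a b} → embed h a ≺ embed h b → a ≺ b
    reflect (le , ne) = embed-reflect h le , ne ∘ cong (embed h)
    reflect₂ : ∀ {a b c d} → embed h a ≺ embed h b × embed h c ≺ embed h d → a ≺ b × c ≺ d
    reflect₂ = Product.map reflect reflect

  embed-here : (h : LeafAt {t = s} pw w) → embed h here ≡ here
  embed-here atLeaf      = refl
  embed-here (inLeft h)  = refl
  embed-here (inRight h) = refl

  data SplitSiblings {s : Tree V} {pw : Pos s} {w : V} (h : LeafAt pw w) : Pos (split h) → Pos (split h) → Set where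
    cherry : SplitSiblings h (keptLeaf h) (newLeaf h)
    old    : {a b : Pos s} → Siblings a b → SplitSiblings h (embed h a) (embed h b)

  private
    siblingsˡ : ∀ {l r : Tree V} {pw : Pos l} {h : LeafAt pw w} {q₁ q₂} →
                SplitSiblings h q₁ q₂ → SplitSiblings (inLeft {r = r} h) (left q₁) (left q₂)
    siblingsˡ cherry  = cherry
    siblingsˡ (old s) = old (sibL s)

    siblingsʳ : ∀ {l r : Tree V} {pw : Pos r} {h : LeafAt pw w} {q₁ q₂} →
                SplitSiblings h q₁ q₂ → SplitSiblings (inRight {l = l} h) (right q₁) (right q₂)
    siblingsʳ cherry  = cherry
    siblingsʳ (old s) = old (sibR s)

  siblings-split : (h : LeafAt {t = s} pw w) {q₁ q₂ : Pos (split h)} → Siblings q₁ q₂ → SplitSiblings h q₁ q₂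
  siblings-split atLeaf      sibs     = cherry
  siblings-split (inLeft {r = r} h) sibs =
    subst (λ q → SplitSiblings (inLeft {r = r} h) (left q) (right here)) (embed-here h) (old sibs)
  siblings-split (inLeft h)  (sibL s) = siblingsˡ (siblings-split h s)
  siblings-split (inLeft h)  (sibR s) = old (sibR s)
  siblings-split (inRight {l = l} h) sibs =
    subst (λ q → SplitSiblings (inRight {l = l} h) (left here) (right q)) (embed-here h) (old sibs)
  siblings-split (inRight h) (sibL s) = old (sibL s)
  siblings-split (inRight h) (sibR s) = siblingsʳ (siblings-split h s)

-- Adjacency in signed tree models

PairLe-swap : ∀ {u u' : Pos t} → PairLe u u' p q → PairLe u u' q p
PairLe-swap (inj₁ (u≼p , u'≼q)) = inj₂ (u'≼q , u≼p)
PairLe-swap (inj₂ (u'≼p , u≼q)) = inj₁ (u≼q , u'≼p)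

PairLe-antisym : ∀ {c d : Pos t} → Transversal p q → PairLe p q c d → PairLe c d p q → SamePair p q c d
PairLe-antisym _   (inj₁ (p≼c , q≼d)) (inj₁ (c≼p , d≼q)) = inj₁ (≼-antisym p≼c c≼p , ≼-antisym q≼d d≼q)
PairLe-antisym _   (inj₂ (q≼c , p≼d)) (inj₂ (d≼p , c≼q)) = inj₂ (≼-antisym p≼d d≼p , ≼-antisym q≼c c≼q)
PairLe-antisym tpq (inj₁ (p≼c , _))   (inj₂ (_ , c≼q))   = ⊥-elim (proj₁ tpq (≼-trans p≼c c≼q))
PairLe-antisym tpq (inj₂ (q≼c , _))   (inj₁ (c≼p , _))   = ⊥-elim (proj₂ tpq (≼-trans q≼c c≼p))

module _ (M : SignedTreeModel V) where

  ABEdge-sym : {p q : Pos (T M)} → ABEdge M p q → ABEdge M q p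
  ABEdge-sym {p} {q} = subst (_≡ true) (cong₂ _∨_ (A-sym M p q) (B-sym M p q))

  ABEdge-transversal : {p q : Pos (T M)} → ABEdge M p q → Transversal p q
  ABEdge-transversal {p} {q} e with A M p q in Apq
  ... | true  = A-transversal M p q Apq
  ... | false = B-transversal M p q e

  ModelAdj-sym : {p q : Pos (T M)} → ModelAdj M p q → ModelAdj M q p
  ModelAdj-sym (u , u' , Bu , u≤pq , no-A-between) =
    u , u' , Bu , PairLe-swap u≤pq ,
    λ (a , a' , Aa , u<a , a≤qp) → no-A-between (a , a' , Aa , u<a , PairLe-swap a≤qp)

  -- A pair pq of the model is the last pair on the way down to pq, so its own colour decides.
  ModelAdj⇔B : {p q : Pos (T M)} → ABEdge M p q → ModelAdj M p q ⇔ (B M p q ≡ true)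
  ModelAdj⇔B {p} {q} e = mk⇔ to from
    where
    to : ModelAdj M p q → B M p q ≡ true
    to (u , u' , Bu , u≤pq , no-A-between) with B M p q in Bpq
    ... | true  = refl
    ... | false = ⊥-elim (no-A-between (p , q , A-pq , (u≤pq , u≢pq) , inj₁ (≼-refl , ≼-refl)))
      where
      A-pq : A M p q ≡ true
      A-pq = trans (sym (∨-identityʳ (A M p q))) e
      u≢pq : ¬ SamePair u u' p q
      u≢pq (inj₁ (refl , refl)) with () ← trans (sym Bu) Bpq
      u≢pq (inj₂ (refl , refl)) with () ← trans (sym Bu) (trans (B-sym M u u') Bpq)
    from : B M p q ≡ true → ModelAdj M p q
    from Bpq = p , q , Bpq , inj₁ (≼-refl , ≼-refl) ,
      λ (_ , _ , _ , (pq≤a , pq≢a) , a≤pq) → pq≢a (PairLe-antisym (ABEdge-transversal e) pq≤a a≤pq)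

module _ (M M' : SignedTreeModel V) (f : Pos (T M) → Pos (T M'))
         (f-mono : ∀ {a b} → a ≼ b → f a ≼ f b) (f-reflect : ∀ {a b} → f a ≼ f b → a ≼ b)
         (f-A : ∀ a b → A M' (f a) (f b) ≡ A M a b) (f-B : ∀ a b → B M' (f a) (f b) ≡ B M a b) where

  private
    f-PairLe : ∀ {a b c d} → PairLe a b c d → PairLe (f a) (f b) (f c) (f d)
    f-PairLe = Sum.map (Product.map f-mono f-mono) (Product.map f-mono f-mono)

    f-PairLe⁻ : ∀ {a b c d} → PairLe (f a) (f b) (f c) (f d) → PairLe a b c d
    f-PairLe⁻ = Sum.map (Product.map f-reflect f-reflect) (Product.map f-reflect f-reflect)

    f-injective : ∀ {a b} → f a ≡ f b → a ≡ b
    f-injective {a} e = ≼-antisym (f-reflect (subst (f a ≼_) e ≼-refl)) (f-reflect (subst (_≼ f a) e ≼-refl))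

    f-SamePair : ∀ {a b c d} → SamePair a b c d → SamePair (f a) (f b) (f c) (f d)
    f-SamePair = Sum.map (Product.map (cong f) (cong f)) (Product.map (cong f) (cong f))

    f-SamePair⁻ : ∀ {a b c d} → SamePair (f a) (f b) (f c) (f d) → SamePair a b c d
    f-SamePair⁻ = Sum.map (Product.map f-injective f-injective) (Product.map f-injective f-injective)

  -- ModelAdj only sees the pairs below the two leaves, so it is invariant under an
  -- order embedding that is onto those pairs.
  ModelAdj-transport : ∀ {p₀ q₀ p q} → f p₀ ≼ p → f q₀ ≼ q →
    (∀ {u u'} → u ≼ p → u' ≼ q → ABEdge M' u u' → ∃₂ λ a b → u ≡ f a × u' ≡ f b × a ≼ p₀ × b ≼ q₀) →
    ModelAdj M p₀ q₀ ⇔ ModelAdj M' p q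
  ModelAdj-transport {p₀} {q₀} {p} {q} fp₀≼p fq₀≼q below = mk⇔ to from
    where
    push : ∀ {a b} → PairLe a b p₀ q₀ → PairLe (f a) (f b) p q
    push = Sum.map (Product.map (λ a≼ → ≼-trans (f-mono a≼) fp₀≼p) (λ b≼ → ≼-trans (f-mono b≼) fq₀≼q))
                   (Product.map (λ b≼ → ≼-trans (f-mono b≼) fp₀≼p) (λ a≼ → ≼-trans (f-mono a≼) fq₀≼q))

    pull : ∀ {u u'} → PairLe u u' p q → ABEdge M' u u' →
           ∃₂ λ a b → u ≡ f a × u' ≡ f b × PairLe a b p₀ q₀
    pull (inj₁ (u≼p , u'≼q)) e with below u≼p u'≼q e
    ... | a , b , refl , refl , a≼ , b≼ = a , b , refl , refl , inj₁ (a≼ , b≼)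
    pull (inj₂ (u'≼p , u≼q)) e with below u'≼p u≼q (ABEdge-sym M' e)
    ... | b , a , refl , refl , b≼ , a≼ = a , b , refl , refl , inj₂ (b≼ , a≼)

    to : ModelAdj M p₀ q₀ → ModelAdj M' p q
    to (a , b , Bab , ab≤ , no-A-between) =
      f a , f b , trans (f-B a b) Bab , push ab≤ ,
      λ (_ , _ , Au , (fab≤u , fab≢u) , u≤pq) → no-A-between' Au fab≤u fab≢u u≤pq
      where
      no-A-between' : ∀ {u u'} → A M' u u' ≡ true → PairLe (f a) (f b) u u' →
                      ¬ SamePair (f a) (f b) u u' → PairLe u u' p q → ⊥
      no-A-between' Au fab≤u fab≢u u≤pq with pull u≤pq (cong (_∨ _) Au)
      ... | c , d , refl , refl , cd≤ =
        no-A-between (c , d , trans (sym (f-A c d)) Au , (f-PairLe⁻ fab≤u , fab≢u ∘ f-SamePair) , cd≤)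

    from : ModelAdj M' p q → ModelAdj M p₀ q₀
    from (u , u' , Bu , u≤pq , no-A-between) with pull u≤pq (trans (cong (A M' u u' ∨_) Bu) (∨-zeroʳ _))
    ... | a , b , refl , refl , ab≤ =
      a , b , trans (sym (f-B a b)) Bu , ab≤ ,
      λ (c , d , Acd , (ab≤cd , ab≢cd) , cd≤) →
        no-A-between (f c , f d , trans (f-A c d) Acd , (f-PairLe ab≤cd , ab≢cd ∘ f-SamePair⁻) , push cd≤)

-- Vertices distinguishing two vertices

elements : ∀ {n} → (Fin n → Bool) → List (Fin n)
elements {zero}  P = []
elements {suc n} P = if P fzero then fzero ∷ rest else rest
  where rest = map fsuc (elements (P ∘ fsuc))

length-elements : ∀ {n} (P : Fin n → Bool) → length (elements P) ≡ count P
length-elements {zero}  P = refl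
length-elements {suc n} P with P fzero
... | true  = cong suc (trans (length-map fsuc (elements (P ∘ fsuc))) (length-elements (P ∘ fsuc)))
... | false = trans (length-map fsuc (elements (P ∘ fsuc))) (length-elements (P ∘ fsuc))

∈-elements : ∀ {n} (P : Fin n → Bool) {i : Fin n} → P i ≡ true → i ∈ elements P
∈-elements {suc n} P {fzero} Pi with P fzero
... | true = here refl
∈-elements {suc n} P {fsuc i} Pi with P fzero
... | true  = there (∈-map⁺ fsuc (∈-elements (P ∘ fsuc) Pi))
... | false = ∈-map⁺ fsuc (∈-elements (P ∘ fsuc) Pi)

module _ {n} (G : Graph n) (R : Fin n → Bool) (u v : Fin n) where

  -- sdIn G R u v is definitionally count distinguishes.
  distinguishes : Fin n → Bool
  distinguishes x = R x ∧ not ⌊ x Fin.≟ u ⌋ ∧ not ⌊ x Fin.≟ v ⌋ ∧ (adj G u x xor adj G v x)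

  distinguishes⇒≢ʳ : ∀ {x} → distinguishes x ≡ true → x ≢ v
  distinguishes⇒≢ʳ {x} D = toWitnessFalse (Equivalence.from T-≡ x≢v)
    where
    x≢v : not ⌊ x Fin.≟ v ⌋ ≡ true
    x≢v = ∧-conicalˡ _ _ (∧-conicalʳ (not ⌊ x Fin.≟ u ⌋) _ (∧-conicalʳ (R x) _ D))

  ¬distinguishes⇒adj≡ : ∀ {x} → R x ≡ true → x ≢ u → x ≢ v → distinguishes x ≡ false →
                        adj G u x ≡ adj G v x
  ¬distinguishes⇒adj≡ {x} Rx x≢u x≢v D = xor≡false⇒≡ (trans (sym unfold) D)
    where
    isYes-false : ∀ {P : Set} (P? : Dec P) → ¬ P → ⌊ P? ⌋ ≡ false
    isYes-false P? ¬P = trans (isYes≗does P?) (dec-false P? ¬P)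

    unfold : distinguishes x ≡ (adj G u x xor adj G v x)
    unfold = cong₂ (λ r (b , c) → r ∧ not b ∧ not c ∧ (adj G u x xor adj G v x))
                   Rx (cong₂ _,_ (isYes-false (x Fin.≟ u) x≢u) (isYes-false (x Fin.≟ v) x≢v))

    xor≡false⇒≡ : ∀ {a b} → (a xor b) ≡ false → a ≡ b
    xor≡false⇒≡ {true}  {true}  _  = refl
    xor≡false⇒≡ {false} {false} _  = refl
    xor≡false⇒≡ {true}  {false} ()
    xor≡false⇒≡ {false} {true}  ()

≡true-cong : ∀ {a b : Bool} → a ≡ b → (a ≡ true) ⇔ (b ≡ true)
≡true-cong refl = mk⇔ id id

-- Clean models of induced subgraphs

record Represents {n} (G : Graph n) (S : Fin n → Set) (M : SignedTreeModel (Fin n)) : Set where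
  field
    leaf-unique : ∀ {p q : Pos (T M)} {x} → LeafAt p x → LeafAt q x → p ≡ q
    leaf-exists : ∀ {x} → S x → ∃ λ (p : Pos (T M)) → LeafAt p x
    leaf-in     : ∀ {p : Pos (T M)} {x} → LeafAt p x → S x
    adjacency   : ∀ {x y} {p q : Pos (T M)} → x ≢ y → LeafAt p x → LeafAt q y →
                  (adj G x y ≡ true ⇔ ModelAdj M p q)

record CleanModel {n} (G : Graph n) (d : ℕ) (S : Fin n → Set) : Set where
  field
    model      : SignedTreeModel (Fin n)
    clean      : Clean model
    width      : WidthAtMost model (suc d)
    represents : Represents G S model

module _ {n} {G : Graph n} {d : ℕ} where

  CleanModel-cong : ∀ {S S'} → (∀ {x} → S x ⇔ S' x) → CleanModel G d S → CleanModel G d S'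
  CleanModel-cong S⇔S' C = record
    { model = model ; clean = clean ; width = width
    ; represents = record
      { leaf-unique = leaf-unique
      ; leaf-exists = leaf-exists ∘ Equivalence.from S⇔S'
      ; leaf-in     = Equivalence.to S⇔S' ∘ leaf-in
      ; adjacency   = adjacency
      }
    }
    where
    open CleanModel C
    open Represents represents

  singleton : (u : Fin n) → CleanModel G d (_≡ u)
  singleton u = record
    { model = record
      { T = leaf u
      ; A = λ _ _ → false
      ; B = λ _ _ → false
      ; A-sym = λ _ _ → refl
      ; B-sym = λ _ _ → refl
      ; A-transversal = λ _ _ ()
      ; B-transversal = λ _ _ ()
      ; disjoint = λ _ _ _ → refl
      ; noCross = λ _ _ _ _ ()
      }
    ; clean = λ _ _ ()
    ; width = (λ _ → 0) , (λ { {here} {here} _ → refl }) , λ _ → [] , z≤n , λ _ _ ()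
    ; represents = record
      { leaf-unique = λ { atLeaf atLeaf → refl }
      ; leaf-exists = λ { refl → here , atLeaf }
      ; leaf-in     = λ { atLeaf → refl }
      ; adjacency   = λ { x≢y atLeaf atLeaf → ⊥-elim (x≢y refl) }
      }
    }

-- v is added next to its partner w ∈ S; R is the vertex set in which sd(v, w) is measured and only
-- needs to contain S.
module Extension {n} {G : Graph n} {d : ℕ} {S : Fin n → Set} (C : CleanModel G d S)
                 (R : Fin n → Bool) (S⊆R : ∀ {z} → S z → R z ≡ true)
                 {v w : Fin n} (v∉S : ¬ S v) (w∈S : S w) (sd≤d : sdIn G R v w ≤ d) where

  open CleanModel C renaming (model to M)
  open Represents represents
  open Split v
  open Related.EquationalReasoning {k = equivalence}

  pw : Pos (T M)
  pw = proj₁ (leaf-exists w∈S)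

  hw : LeafAt pw w
  hw = proj₂ (leaf-exists w∈S)

  T⁺ : Tree (Fin n)
  T⁺ = split hw

  S⇒≢v : ∀ {z} → S z → z ≢ v
  S⇒≢v Sz refl = v∉S Sz

  D : Fin n → Bool
  D = distinguishes G R v w

  linkedVertex : Maybe (Fin n) → Maybe (Fin n)
  linkedVertex m = m >>= λ z → if D z then just z else nothing

  linked : {q : Pos T⁺} → View hw q → Maybe (Fin n)
  linked (old a) = linkedVertex (label a)
  linked kept    = just w
  linked new     = nothing

  antiTo blueTo : Maybe (Fin n) → Bool
  antiTo = maybe′ (not ∘ adj G v) false
  blueTo = maybe′ (adj G v) false

  extendRel : (Pos (T M) → Pos (T M) → Bool) → (Maybe (Fin n) → Bool) →
              {q₁ q₂ : Pos T⁺} → View hw q₁ → View hw q₂ → Bool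
  extendRel P f (old a) (old b) = P a b
  extendRel P f new     c       = f (linked c)
  extendRel P f c       new     = f (linked c)
  extendRel P f _       _       = false

  A⁺ B⁺ : Pos T⁺ → Pos T⁺ → Bool
  A⁺ q₁ q₂ = extendRel (A M) antiTo (view hw q₁) (view hw q₂)
  B⁺ q₁ q₂ = extendRel (B M) blueTo (view hw q₁) (view hw q₂)

  edge⁺ : {q₁ q₂ : Pos T⁺} → View hw q₁ → View hw q₂ → Bool
  edge⁺ c₁ c₂ = extendRel (A M) antiTo c₁ c₂ ∨ extendRel (B M) blueTo c₁ c₂

  Edge⁺ : Pos T⁺ → Pos T⁺ → Set
  Edge⁺ q₁ q₂ = edge⁺ (view hw q₁) (view hw q₂) ≡ true

  extendRel-sym : ∀ {P f} → (∀ a b → P a b ≡ P b a) → ∀ {q₁ q₂} (c₁ : View hw q₁) (c₂ : View hw q₂) →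
                  extendRel P f c₁ c₂ ≡ extendRel P f c₂ c₁
  extendRel-sym P-sym (old a) (old b) = P-sym a b
  extendRel-sym P-sym (old a) kept    = refl
  extendRel-sym P-sym (old a) new     = refl
  extendRel-sym P-sym kept    (old b) = refl
  extendRel-sym P-sym kept    kept    = refl
  extendRel-sym P-sym kept    new     = refl
  extendRel-sym P-sym new     (old b) = refl
  extendRel-sym P-sym new     kept    = refl
  extendRel-sym P-sym new     new     = refl

  extendRel-embed : ∀ {P f} a b → extendRel P f (view hw (embed hw a)) (view hw (embed hw b)) ≡ P a b
  extendRel-embed a b = cong₂ (extendRel _ _) (view-embed hw a) (view-embed hw b)

  Edge⁺-sym : ∀ {q₁ q₂} → Edge⁺ q₁ q₂ → Edge⁺ q₂ q₁
  Edge⁺-sym {q₁} {q₂} = subst (_≡ true) (cong₂ _∨_ (extendRel-sym (A-sym M) (view hw q₁) (view hw q₂))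
                                                  (extendRel-sym (B-sym M) (view hw q₁) (view hw q₂)))

  linked-old : ∀ {a z} → linked (old a) ≡ just z → LeafAt a z × D z ≡ true
  linked-old {a} e with label a in la
  ... | just z' with D z' in Dz'
  linked-old {a} refl | just z' | true = label-sound la , Dz'

  linked-leaf : ∀ {q z} (c : View hw q) → linked c ≡ just z → LeafAt q z × S z
  linked-leaf (old a) e with linked-old e
  ... | ha , Dz = embed-leaf hw a≢pw ha , leaf-in ha
    where
    a≢pw : a ≢ pw
    a≢pw refl = distinguishes⇒≢ʳ G R v w Dz (LeafAt-functional ha hw)
  linked-leaf kept refl = keptLeaf-leaf hw , w∈S

  antiTo∨blueTo⇒just : ∀ {m} → (antiTo m ∨ blueTo m) ≡ true → ∃ λ z → m ≡ just z
  antiTo∨blueTo⇒just {just z} _ = z , refl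

  Edge⁺-newLeaf : ∀ {q} → Edge⁺ (newLeaf hw) q → ∃ λ z → linked (view hw q) ≡ just z
  Edge⁺-newLeaf {q} e = antiTo∨blueTo⇒just (subst (λ c → edge⁺ c (view hw q) ≡ true) (view-newLeaf hw) e)

  Edge⁺-old : ∀ {u u'} → u ≢ newLeaf hw → u' ≢ newLeaf hw → Edge⁺ u u' →
              ∃₂ λ a b → u ≡ embed hw a × u' ≡ embed hw b × ABEdge M a b
  Edge⁺-old {u} {u'} = go (view hw u) (view hw u')
    where
    go : ∀ {u u'} (c : View hw u) (c' : View hw u') → u ≢ newLeaf hw → u' ≢ newLeaf hw → edge⁺ c c' ≡ true →
         ∃₂ λ a b → u ≡ embed hw a × u' ≡ embed hw b × ABEdge M a b
    go (old a) (old b) _   _    e  = a , b , refl , refl , e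
    go new     _       u≢  _    _  = ⊥-elim (u≢ refl)
    go _       new     _   u'≢  _  = ⊥-elim (u'≢ refl)
    go (old a) kept    _   _    ()
    go kept    (old b) _   _    ()
    go kept    kept    _   _    ()

  Edge⁺-newLeaf-leaves : ∀ {q} → Edge⁺ (newLeaf hw) q →
                         ∃₂ λ x y → LeafAt (newLeaf hw) x × LeafAt q y × x ≢ y
  Edge⁺-newLeaf-leaves {q} e with z , lz ← Edge⁺-newLeaf e with hq , Sz ← linked-leaf (view hw q) lz =
    v , z , newLeaf-leaf hw , hq , S⇒≢v Sz ∘ sym

  Edge⁺-old⊎leaves : ∀ {u u'} → Edge⁺ u u' →
    (∃₂ λ a b → u ≡ embed hw a × u' ≡ embed hw b × ABEdge M a b) ⊎
    (∃₂ λ x y → LeafAt u x × LeafAt u' y × x ≢ y)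
  Edge⁺-old⊎leaves {u} {u'} e with u ≟ₚ newLeaf hw | u' ≟ₚ newLeaf hw
  ... | no u≢    | no u'≢  = inj₁ (Edge⁺-old u≢ u'≢ e)
  ... | yes refl | _       = inj₂ (Edge⁺-newLeaf-leaves e)
  ... | no _     | yes refl with x , y , hx , hy , x≢y ← Edge⁺-newLeaf-leaves (Edge⁺-sym e) =
    inj₂ (y , x , hy , hx , x≢y ∘ sym)

  Edge⁺-transversal : ∀ {u u'} → Edge⁺ u u' → Transversal u u'
  Edge⁺-transversal e with Edge⁺-old⊎leaves e
  ... | inj₁ (a , b , refl , refl , ab) =
    Product.map (_∘ embed-reflect hw) (_∘ embed-reflect hw) (ABEdge-transversal M ab)
  ... | inj₂ (x , y , hx , hy , x≢y) =
    leaves-transversal hx hy λ { refl → x≢y (LeafAt-functional hx hy) }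

  Edge⁺-¬Cross : ∀ {u u' u'' u'''} → Edge⁺ u u' → Edge⁺ u'' u''' → ¬ Cross u u' u'' u'''
  Edge⁺-¬Cross e e' with Edge⁺-old⊎leaves e | Edge⁺-old⊎leaves e'
  ... | inj₂ (_ , _ , hu , hu' , _) | _ = leaves-¬Crossˡ hu hu'
  ... | inj₁ _ | inj₂ (_ , _ , hu'' , hu''' , _) = leaves-¬Crossʳ hu'' hu'''
  ... | inj₁ (a , b , refl , refl , ab) | inj₁ (c , d , refl , refl , cd) = noCross M a b c d ab cd ∘ embed-Cross⁻ hw

  extendRel-disjoint : ∀ {q₁ q₂} (c₁ : View hw q₁) (c₂ : View hw q₂) →
                       extendRel (A M) antiTo c₁ c₂ ≡ true → extendRel (B M) blueTo c₁ c₂ ≡ false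
  extendRel-disjoint (old a) (old b) = disjoint M a b
  extendRel-disjoint new     c       = antiTo⇒¬blueTo (linked c)
    where
    antiTo⇒¬blueTo : ∀ m → antiTo m ≡ true → blueTo m ≡ false
    antiTo⇒¬blueTo (just z) e = trans (sym (not-involutive _)) (cong not e)
  extendRel-disjoint (old a) new     = extendRel-disjoint new (old a)
  extendRel-disjoint kept    new     = extendRel-disjoint new kept
  extendRel-disjoint (old a) kept    ()
  extendRel-disjoint kept    (old b) ()
  extendRel-disjoint kept    kept    ()

  M⁺ : SignedTreeModel (Fin n)
  M⁺ = record
    { T = T⁺
    ; A = A⁺
    ; B = B⁺
    ; A-sym = λ q₁ q₂ → extendRel-sym (A-sym M) (view hw q₁) (view hw q₂)
    ; B-sym = λ q₁ q₂ → extendRel-sym (B-sym M) (view hw q₁) (view hw q₂)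
    ; A-transversal = λ q₁ q₂ e → Edge⁺-transversal (cong (_∨ B⁺ q₁ q₂) e)
    ; B-transversal = λ q₁ q₂ e → Edge⁺-transversal (trans (cong (A⁺ q₁ q₂ ∨_) e) (∨-zeroʳ _))
    ; disjoint = λ q₁ q₂ → extendRel-disjoint (view hw q₁) (view hw q₂)
    ; noCross = λ _ _ _ _ → Edge⁺-¬Cross
    }

  clean⁺ : Clean M⁺
  clean⁺ _ _ s with siblings-split hw s
  ... | cherry = subst₂ (λ c₁ c₂ → edge⁺ c₁ c₂ ≡ true) (sym (view-keptLeaf hw)) (sym (view-newLeaf hw))
                        (∨-inverseˡ (adj G v w))
  ... | old {a} {b} s' = trans (cong₂ _∨_ (extendRel-embed a b) (extendRel-embed a b)) (clean a b s')

  private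
    r : Pos (T M) → ℕ
    r = proj₁ width

    r-injective : Injective _≡_ _≡_ r
    r-injective = proj₁ (proj₂ width)

    laterOf : Pos (T M) → List (Pos (T M))
    laterOf a = proj₁ (proj₂ (proj₂ width) a)

    length-laterOf : ∀ a → length (laterOf a) ≤ suc d
    length-laterOf a = proj₁ (proj₂ (proj₂ (proj₂ width) a))

    laterOf-complete : ∀ a b → r a < r b → ABEdge M a b → b ∈ laterOf a
    laterOf-complete a = proj₂ (proj₂ (proj₂ (proj₂ width) a))

  -- The new leaf comes first and the kept leaf second, so every pair at the new leaf points
  -- forward: to the kept leaf or to the leaf of one of the ≤ d vertices distinguishing v from w.
  rank⁺ : ∀ {q} → View hw q → ℕ
  rank⁺ (old a) = suc (suc (r a))
  rank⁺ kept    = 1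
  rank⁺ new     = 0

  rank⁺-injective : ∀ {q₁ q₂} (c₁ : View hw q₁) (c₂ : View hw q₂) → rank⁺ c₁ ≡ rank⁺ c₂ → q₁ ≡ q₂
  rank⁺-injective (old a) (old b) e = cong (embed hw) (r-injective (suc-injective (suc-injective e)))
  rank⁺-injective kept    kept    _ = refl
  rank⁺-injective new     new     _ = refl
  rank⁺-injective (old a) kept    ()
  rank⁺-injective (old a) new     ()
  rank⁺-injective kept    (old b) ()
  rank⁺-injective kept    new     ()
  rank⁺-injective new     (old b) ()
  rank⁺-injective new     kept    ()

  leafOf : Fin n → Pos (T M)
  leafOf z with leaf? Fin._≟_ (T M) z
  ... | yes (p , _) = p
  ... | no _        = here   -- junk: only leaves that exist must appear in later⁺ new

  leafOf-leaf : ∀ {b z} → LeafAt b z → leafOf z ≡ b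
  leafOf-leaf {b} {z} hb with leaf? Fin._≟_ (T M) z
  ... | yes (p , hp) = leaf-unique hp hb
  ... | no ∄p        = ⊥-elim (∄p (b , hb))

  later⁺ : ∀ {q} → View hw q → List (Pos T⁺)
  later⁺ (old a) = map (embed hw) (laterOf a)
  later⁺ kept    = []
  later⁺ new     = keptLeaf hw ∷ map (embed hw ∘ leafOf) (elements D)

  length-later⁺ : ∀ {q} (c : View hw q) → length (later⁺ c) ≤ suc d
  length-later⁺ (old a) =
    subst (_≤ suc d) (sym (length-map (embed hw) (laterOf a))) (length-laterOf a)
  length-later⁺ kept    = z≤n
  length-later⁺ new     =
    s≤s (subst (_≤ d) (sym (trans (length-map (embed hw ∘ leafOf) (elements D)) (length-elements D))) sd≤d)

  later⁺-complete : ∀ {q₁ q₂} (c₁ : View hw q₁) (c₂ : View hw q₂) →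
                    rank⁺ c₁ < rank⁺ c₂ → edge⁺ c₁ c₂ ≡ true → q₂ ∈ later⁺ c₁
  later⁺-complete (old a) (old b) (s≤s (s≤s ra<rb)) e =
    ∈-map⁺ (embed hw) (laterOf-complete a b ra<rb e)
  later⁺-complete new     kept    _ _ = here refl
  later⁺-complete new     (old b) _ e with z , lz ← antiTo∨blueTo⇒just e with hb , Dz ← linked-old lz =
    there (subst (λ p → embed hw p ∈ _) (leafOf-leaf hb) (∈-map⁺ (embed hw ∘ leafOf) (∈-elements D Dz)))
  later⁺-complete (old a) kept    _         ()
  later⁺-complete (old a) new     ()
  later⁺-complete kept    (old b) _         ()
  later⁺-complete kept    kept    (s≤s ())
  later⁺-complete kept    new     ()
  later⁺-complete new     new     ()

  width⁺ : WidthAtMost M⁺ (suc d)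
  width⁺ = (λ q → rank⁺ (view hw q)) ,
           (λ {q₁} {q₂} → rank⁺-injective (view hw q₁) (view hw q₂)) ,
           λ q → later⁺ (view hw q) , length-later⁺ (view hw q) ,
                 λ q' → later⁺-complete (view hw q) (view hw q')

  leaf-in⁺ : ∀ {q x} → LeafAt q x → S x ⊎ x ≡ v
  leaf-in⁺ hq = go (view hw _) hq
    where
    go : ∀ {q x} → View hw q → LeafAt q x → S x ⊎ x ≡ v
    go (old a) ha = inj₁ (leaf-in (proj₂ (embed-leaf⁻ hw ha)))
    go kept    hk = inj₁ (subst S (LeafAt-functional (keptLeaf-leaf hw) hk) w∈S)
    go new     hn = inj₂ (LeafAt-functional hn (newLeaf-leaf hw))

  leaf-exists⁺ : ∀ {x} → S x ⊎ x ≡ v → ∃ λ q → LeafAt q x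
  leaf-exists⁺ (inj₂ refl) = newLeaf hw , newLeaf-leaf hw
  leaf-exists⁺ (inj₁ Sx) with b , hb ← leaf-exists Sx with b ≟ₚ pw
  ... | yes refl = keptLeaf hw , subst (LeafAt (keptLeaf hw)) (LeafAt-functional hw hb) (keptLeaf-leaf hw)
  ... | no b≢pw  = embed hw b , embed-leaf hw b≢pw hb

  leaf-unique⁺ : ∀ {q₁ q₂ x} → LeafAt q₁ x → LeafAt q₂ x → q₁ ≡ q₂
  leaf-unique⁺ h₁ h₂ = go (view hw _) (view hw _) h₁ h₂
    where
    old-label : ∀ {a x} → LeafAt (embed hw a) x → x ≢ w × x ≢ v
    old-label ha with a≢pw , ha' ← embed-leaf⁻ hw ha =
      (λ { refl → a≢pw (leaf-unique ha' hw) }) , S⇒≢v (leaf-in ha')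

    kept-label : ∀ {x} → LeafAt (keptLeaf hw) x → x ≡ w
    kept-label hk = LeafAt-functional hk (keptLeaf-leaf hw)

    new-label : ∀ {x} → LeafAt (newLeaf hw) x → x ≡ v
    new-label hn = LeafAt-functional hn (newLeaf-leaf hw)

    go : ∀ {q₁ q₂ x} → View hw q₁ → View hw q₂ → LeafAt q₁ x → LeafAt q₂ x → q₁ ≡ q₂
    go (old a) (old b) ha hb =
      cong (embed hw) (leaf-unique (proj₂ (embed-leaf⁻ hw ha)) (proj₂ (embed-leaf⁻ hw hb)))
    go kept    kept    _  _  = refl
    go new     new     _  _  = refl
    go (old a) kept    ha hk = ⊥-elim (proj₁ (old-label ha) (kept-label hk))
    go kept    (old b) hk hb = ⊥-elim (proj₁ (old-label hb) (kept-label hk))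
    go (old a) new     ha hn = ⊥-elim (proj₂ (old-label ha) (new-label hn))
    go new     (old b) hn hb = ⊥-elim (proj₂ (old-label hb) (new-label hn))
    go kept    new     hk hn = ⊥-elim (S⇒≢v w∈S (trans (sym (kept-label hk)) (new-label hn)))
    go new     kept    hn hk = ⊥-elim (S⇒≢v w∈S (trans (sym (kept-label hk)) (new-label hn)))

  ModelAdj-contract : ∀ {p q} → (∀ {u u'} → u ≼ p → u' ≼ q → Edge⁺ u u' → u ≢ newLeaf hw × u' ≢ newLeaf hw) →
                      ModelAdj M (contract hw p) (contract hw q) ⇔ ModelAdj M⁺ p q
  ModelAdj-contract {p} {q} avoids =
    ModelAdj-transport M M⁺ (embed hw) (embed-mono hw) (embed-reflect hw) extendRel-embed extendRel-embed
      (≼contract⇒embed≼ hw ≼-refl) (≼contract⇒embed≼ hw ≼-refl) below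
    where
    below : ∀ {u u'} → u ≼ p → u' ≼ q → Edge⁺ u u' →
            ∃₂ λ a b → u ≡ embed hw a × u' ≡ embed hw b × a ≼ contract hw p × b ≼ contract hw q
    below u≼p u'≼q e with u≢ , u'≢ ← avoids u≼p u'≼q e with a , b , refl , refl , _ ← Edge⁺-old u≢ u'≢ e =
      a , b , refl , refl , embed≼⇒≼contract hw u≼p , embed≼⇒≼contract hw u'≼q

  ≼⇒≢newLeaf : ∀ {u p} → p ≢ newLeaf hw → u ≼ p → u ≢ newLeaf hw
  ≼⇒≢newLeaf p≢ u≼p refl = p≢ (LeafAt-maximal (newLeaf-leaf hw) u≼p)

  adjacency-old : ∀ {x y p q} → p ≢ newLeaf hw → q ≢ newLeaf hw → x ≢ y → LeafAt p x → LeafAt q y →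
                  adj G x y ≡ true ⇔ ModelAdj M⁺ p q
  adjacency-old {x} {y} {p} {q} p≢ q≢ x≢y hp hq = begin
    adj G x y ≡ true                     ∼⟨ adjacency x≢y (contract-leaf hw p≢ hp) (contract-leaf hw q≢ hq) ⟩
    ModelAdj M (contract hw p) (contract hw q) ∼⟨ ModelAdj-contract avoids ⟩
    ModelAdj M⁺ p q                      ∎
    where
    avoids : ∀ {u u'} → u ≼ p → u' ≼ q → Edge⁺ u u' → u ≢ newLeaf hw × u' ≢ newLeaf hw
    avoids u≼p u'≼q _ = ≼⇒≢newLeaf p≢ u≼p , ≼⇒≢newLeaf q≢ u'≼q

  unlinked : ∀ {q y} (c : View hw q) → q ≢ newLeaf hw → LeafAt q y → linked c ≡ nothing →
             S y × y ≢ w × D y ≡ false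
  unlinked (old b) _ hq lq with b≢pw , hb ← embed-leaf⁻ hw hq with label b | label-complete hb
  ... | just y | refl with D y
  ... | false = leaf-in hb , (λ { refl → b≢pw (leaf-unique hb hw) }) , refl
  unlinked new q≢ _ _ = ⊥-elim (q≢ refl)

  adjacency-new : ∀ {y q} → q ≢ newLeaf hw → LeafAt q y → adj G v y ≡ true ⇔ ModelAdj M⁺ (newLeaf hw) q
  adjacency-new {y} {q} q≢ hq with linked (view hw q) in lq
  ... | just z with hz , _ ← linked-leaf (view hw q) lq with refl ← LeafAt-functional hz hq =
    subst (λ b → (b ≡ true) ⇔ ModelAdj M⁺ (newLeaf hw) q) B⁺≡ (⇔-sym (ModelAdj⇔B M⁺ edge))
    where
    B⁺≡ : B⁺ (newLeaf hw) q ≡ adj G v z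
    B⁺≡ = trans (cong (λ c → extendRel (B M) blueTo c (view hw q)) (view-newLeaf hw)) (cong blueTo lq)
    edge : Edge⁺ (newLeaf hw) q
    edge = subst (λ c → edge⁺ c (view hw q) ≡ true) (sym (view-newLeaf hw))
                 (subst (λ m → (antiTo m ∨ blueTo m) ≡ true) (sym lq) (∨-inverseˡ (adj G v z)))
  ... | nothing with Sy , y≢w , Dy ← unlinked (view hw q) q≢ hq lq = begin
    adj G v y ≡ true  ∼⟨ ≡true-cong (¬distinguishes⇒adj≡ G R v w (S⊆R Sy) (S⇒≢v Sy) y≢w Dy) ⟩
    adj G w y ≡ true  ∼⟨ adjacency (y≢w ∘ sym) (subst (λ p → LeafAt p w) (sym (contract-newLeaf hw)) hw)
                                               (contract-leaf hw q≢ hq) ⟩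
    ModelAdj M (contract hw (newLeaf hw)) (contract hw q) ∼⟨ ModelAdj-contract avoids ⟩
    ModelAdj M⁺ (newLeaf hw) q ∎
    where
    avoids : ∀ {u u'} → u ≼ newLeaf hw → u' ≼ q → Edge⁺ u u' → u ≢ newLeaf hw × u' ≢ newLeaf hw
    avoids {u} {u'} _ u'≼q e = u≢ , ≼⇒≢newLeaf q≢ u'≼q
      where
      u≢ : u ≢ newLeaf hw
      u≢ refl with z , lz ← Edge⁺-newLeaf e with hu' , _ ← linked-leaf (view hw u') lz
        with refl ← LeafAt-maximal hu' u'≼q with () ← trans (sym lq) lz

  adjacency⁺ : ∀ {x y p q} → x ≢ y → LeafAt p x → LeafAt q y → adj G x y ≡ true ⇔ ModelAdj M⁺ p q
  adjacency⁺ {x} {y} {p} {q} x≢y hp hq with p ≟ₚ newLeaf hw | q ≟ₚ newLeaf hw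
  ... | no p≢    | no q≢    = adjacency-old p≢ q≢ x≢y hp hq
  ... | yes refl | no q≢ with refl ← LeafAt-functional (newLeaf-leaf hw) hp = adjacency-new q≢ hq
  ... | no p≢    | yes refl with refl ← LeafAt-functional (newLeaf-leaf hw) hq =
    begin
      adj G x v ≡ true          ∼⟨ ≡true-cong (adj-sym G x v) ⟩
      adj G v x ≡ true          ∼⟨ adjacency-new p≢ hp ⟩
      ModelAdj M⁺ (newLeaf hw) p ∼⟨ mk⇔ (ModelAdj-sym M⁺) (ModelAdj-sym M⁺) ⟩
      ModelAdj M⁺ p (newLeaf hw) ∎
  ... | yes refl | yes refl =
    ⊥-elim (x≢y (trans (LeafAt-functional hp (newLeaf-leaf hw)) (LeafAt-functional (newLeaf-leaf hw) hq)))

  extended : CleanModel G d (λ x → S x ⊎ x ≡ v)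
  extended = record
    { model = M⁺
    ; clean = clean⁺
    ; width = width⁺
    ; represents = record
      { leaf-unique = leaf-unique⁺
      ; leaf-exists = leaf-exists⁺
      ; leaf-in     = leaf-in⁺
      ; adjacency   = adjacency⁺
      }
    }

-- Adding the vertices in reverse sd-order

-- Pigeonhole: if i were missed, punching it out would inject Fin (suc m) into Fin m.
injective⇒surjective : ∀ {n} {f : Fin n → Fin n} → Injective _≡_ _≡_ f → ∀ i → ∃ λ x → f x ≡ i
injective⇒surjective {suc m} {f} f-injective i with any? (λ x → f x Fin.≟ i)
... | yes found = found
... | no ∄x     = contradiction (injective⇒≤ {f = missing-i} missing-i-injective) (<-irrefl refl)
  where
  i≢f : ∀ x → i ≢ f x
  i≢f x i≡fx = ∄x (x , sym i≡fx)

  missing-i : Fin (suc m) → Fin m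
  missing-i x = punchOut (i≢f x)

  missing-i-injective : Injective _≡_ _≡_ missing-i
  missing-i-injective e = f-injective (punchOut-injective (i≢f _) (i≢f _) e)

Represents⇒Defines : ∀ {n} {G : Graph n} {S M} → (∀ x → S x) → Represents G S M → Defines M G
Represents⇒Defines {M = M} every rep = leafSet , λ _ _ _ _ → adjacency
  where
  open Represents rep
  leafSet : LeafSetIs M
  leafSet x with p , hp ← leaf-exists (every x) = p , hp , λ _ hq → leaf-unique hq hp

module Construction {m : ℕ} {G : Graph (suc m)} {d : ℕ} (ordering : SdOrdering G d) where

  rank : Fin (suc m) → Fin (suc m)
  rank = proj₁ ordering

  rank-injective : ∀ {x y} → toℕ (rank x) ≡ toℕ (rank y) → x ≡ y
  rank-injective = proj₁ (proj₂ ordering) ∘ toℕ-injective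

  Suffix : ℕ → Fin (suc m) → Set
  Suffix k x = k ≤ toℕ (rank x)

  vertexOfRank : ∀ k → k < suc m → ∃ λ x → toℕ (rank x) ≡ k
  vertexOfRank k k<n with x , e ← injective⇒surjective (proj₁ (proj₂ ordering)) (fromℕ< k<n) =
    x , trans (cong toℕ e) (toℕ-fromℕ< k<n)

  Suffix-last : ∀ {u} → toℕ (rank u) ≡ m → ∀ {x} → x ≡ u ⇔ Suffix m x
  Suffix-last ru = mk⇔ (λ { refl → ≤-reflexive (sym ru) })
                       (λ m≤rx → rank-injective (trans (≤-antisym (≤-pred (toℕ<n (rank _))) m≤rx) (sym ru)))

  Suffix-step : ∀ {k v} → toℕ (rank v) ≡ k → ∀ {x} → (Suffix (suc k) x ⊎ x ≡ v) ⇔ Suffix k x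
  Suffix-step {k} {v} rv {x} = mk⇔ to from
    where
    to : Suffix (suc k) x ⊎ x ≡ v → Suffix k x
    to (inj₁ k<rx) = <⇒≤ k<rx
    to (inj₂ refl) = ≤-reflexive (sym rv)
    from : Suffix k x → Suffix (suc k) x ⊎ x ≡ v
    from k≤rx with toℕ (rank x) ℕ.≟ k
    ... | yes rx≡k = inj₂ (rank-injective (trans rx≡k (sym rv)))
    ... | no  rx≢k = inj₁ (≤∧≢⇒< k≤rx (rx≢k ∘ sym))

  extendSuffix : ∀ {k} → k < m → CleanModel G d (Suffix (suc k)) → CleanModel G d (Suffix k)
  extendSuffix {k} k<m C
    with v , rv ← vertexOfRank k (s≤s (<⇒≤ k<m))
    with w , rv<rw , sd≤d ← proj₂ (proj₂ ordering) v (subst (λ r → suc r < suc m) (sym rv) (s≤s k<m)) =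
    CleanModel-cong (Suffix-step rv) (Extension.extended C (remaining rank v) S⊆R v∉S w∈S sd≤d)
    where
    S⊆R : ∀ {z} → Suffix (suc k) z → remaining rank v z ≡ true
    S⊆R {z} k<rz = trans (isYes≗does rv≤?rz) (dec-true rv≤?rz (subst (_≤ toℕ (rank z)) (sym rv) (<⇒≤ k<rz)))
      where rv≤?rz = toℕ (rank v) ℕ.≤? toℕ (rank z)
    v∉S : ¬ Suffix (suc k) v
    v∉S k<rv = <-irrefl (sym rv) k<rv
    w∈S : Suffix (suc k) w
    w∈S = subst (_< toℕ (rank w)) rv rv<rw

  suffixModel : ∀ e k → k + e ≡ m → CleanModel G d (Suffix k)
  suffixModel zero k k+0≡m with refl ← trans (sym (+-identityʳ k)) k+0≡m
                           with u , ru ← vertexOfRank m ≤-refl =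
    CleanModel-cong (Suffix-last ru) (singleton u)
  suffixModel (suc e) k k+1+e≡m = extendSuffix k<m (suffixModel e (suc k) 1+k+e≡m)
    where
    1+k+e≡m : suc k + e ≡ m
    1+k+e≡m = trans (sym (+-suc k e)) k+1+e≡m
    k<m : k < m
    k<m = subst (suc k ≤_) 1+k+e≡m (m≤m+n (suc k) e)

lemma3p1 : (n : ℕ) → 1 ≤ n → (G : Graph n) → (d : ℕ) → SdDegeneracy G d →
    Σ (SignedTreeModel (Fin n)) λ M → Clean M × WidthAtMost M (suc d) × Defines M G
lemma3p1 (suc m) _ G d (ordering , _) = model , clean , width , Represents⇒Defines (λ _ → z≤n) represents
  where
  open CleanModel (Construction.suffixModel {G = G} ordering m 0 refl)
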